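{- Let $r$ be a positive integer and $m$ a nonnegative integer. Then $$\{m\}_r!=s_1^{h_r(m)}\cdot\phi_r\Bigl(\prod_{j=0}^{r-1}\Bigl\{\Bigl\lceil\tfrac{m-j}{r}\Bigr\rceil\Bigr\}!\Bigr),\qquad\text{where } h_r(m)=\sum_{i=1}^{m}\bigl((i-1)\bmod r\bigr).$$
   Context: Let $s_1,s_2,\dots$ be commuting indeterminates and $\mathbb{Z}[S]=\mathbb{Z}[s_1,s_2,\dots]$. The Lucas polynomials $\{m\}\in\mathbb{Z}[s_1,s_2]$ are defined by $\{0\}=0$, $\{1\}=1$, $\{m\}=s_1\{m-1\}+s_2\{m-2\}$ for $m\ge2$; $\{0\}!=1$ and $\{m\}!=\{m\}\cdot\{m-1\}!$. For a positive integer $r$, $\phi_r:\mathbb{Z}[s_1,s_2]\to\mathbb{Z}[S]$ is the ring homomorphism with $\phi_r(s_1)=s_r$, $\phi_r(s_2)=s_{2r}$. Here $a\bmod r\in\{0,\dots,r-1\}$ is the remainder. For $i\ge1$ let $\tau_i$ be a tile of length $i$; a tiling word of $k\ge0$ is a word $\tau_{i_1}\cdots\tau_{i_j}$ with $i_1+\cdots+i_j=k$ (the empty word for $k=0$), with weight $s_{i_1}\cdots s_{i_j}$. For $m\ge0$, $\Delta_{m,r}$ is the set of tiling words of $m$ consisting of $(m\bmod r)$ tiles $\tau_1$ followed by tiles from $\{\tau_r,\tau_{2r}\}$ in any order. The $r$-Lucas polynomials are $\{0\}_r=0$ and $\{m+1\}_r=\sum_{T\in\Delta_{m,r}}\mathrm{wt}(T)$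 for $m\ge0$; $\{0\}_r!=1$ and $\{m\}_r!=\{m\}_r\cdot\{m-1\}_r!$. -}

module Defs where

open import Level using (Level)
open import Algebra.Bundles using (CommutativeRing)
open import Data.Nat using (ℕ; zero; suc; _∸_; NonZero; _≟_)
  renaming (_*_ to _*ℕ_; _+_ to _+ℕ_)
open import Data.Nat.DivMod using (_/_; _%_)
open import Data.List using (List; []; _∷_; _++_; map; concatMap; filter; replicate; upTo; foldr)
open import Data.Nat.ListAction using () renaming (sum to sumℕ)


-- All words of length ℓ over a given alphabet (tiles given by their lengths).
wordsOfLength : List ℕ → ℕ → List (List ℕ)
wordsOfLength A zero    = [] ∷ []
wordsOfLength A (suc ℓ) = concatMap (λ a → map (a ∷_) (wordsOfLength A ℓ)) A

-- A word with all tiles of length ≥ 1 tiling m has at most m tiles, so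
-- enumerating suffix lengths 0..m is exhaustive.
Δ : (m r : ℕ) → .{{NonZero r}} → List (List ℕ)
Δ m r = filter (λ w → sumℕ w ≟ m)
          (map (replicate (m % r) 1 ++_)
               (concatMap (wordsOfLength (r ∷ (2 *ℕ r) ∷ [])) (upTo (suc m))))

-- ⌈(m - j)/r⌉ for integers m ≥ 0, 0 ≤ j < r (equals 0 when m < j).
ceilDiv : (m j r : ℕ) → .{{NonZero r}} → ℕ
ceilDiv m j r = ((m +ℕ r) ∸ 1 ∸ j) / r

h : (r : ℕ) → .{{NonZero r}} → ℕ → ℕ
h r m = sumℕ (map (λ i → i % r) (upTo m))

-- Evaluation of the polynomials in ℤ[S] in an arbitrary commutative ring R
-- at an arbitrary assignment s : ℕ → R of the indeterminates (s i = s_i).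
module Poly {c ℓ : Level} (R : CommutativeRing c ℓ) (s : ℕ → CommutativeRing.Carrier R) where
  open CommutativeRing R

  pow : Carrier → ℕ → Carrier
  pow x zero    = 1#
  pow x (suc n) = x * pow x n

  prod : List Carrier → Carrier
  prod = foldr _*_ 1#

  sumR : List Carrier → Carrier
  sumR = foldr _+_ 0#

  wt : List ℕ → Carrier
  wt w = prod (map s w)

  lucas : Carrier → Carrier → ℕ → Carrier
  lucas a b zero          = 0#
  lucas a b (suc zero)    = 1#
  lucas a b (suc (suc m)) = a * lucas a b (suc m) + b * lucas a b m

  lucasFact : Carrier → Carrier → ℕ → Carrier
  lucasFact a b zero    = 1#
  lucasFact a b (suc m) = lucas a b (suc m) * lucasFact a b m

  φLucasFact : ℕ → ℕ → Carrier
  φLucasFact r k = lucasFact (s r) (s (2 *ℕ r)) k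

  rLucas : (r : ℕ) → .{{NonZero r}} → ℕ → Carrier
  rLucas r zero    = 0#
  rLucas r (suc m) = sumR (map wt (Δ m r))

  rLucasFact : (r : ℕ) → .{{NonZero r}} → ℕ → Carrier
  rLucasFact r zero    = 1#
  rLucasFact r (suc m) = rLucas r (suc m) * rLucasFact r m

  rhs : (r : ℕ) → .{{NonZero r}} → ℕ → Carrier
  rhs r m = pow (s 1) (h r m) * prod (map (λ j → φLucasFact r (ceilDiv m j r)) (upTo r))

-- Write t = m mod r and q = ⌊m/r⌋. A word of Δ_{m,r} is τ₁^t
-- followed by a word over {τ_r, τ_2r} tiling q r; dividing tile lengths by r
-- identifies these with the tilings of q by τ₁ and τ₂, whose weights (with
-- s_i replaced by s_{ri}) add up to the Lucas polynomial {q+1}, by splitting off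
-- the first tile. Hence {m+1}_r = s₁^t φ_r({q+1}). On the other side, passing
-- from m to m+1 adds t to h_r and raises exactly one ceiling ⌈(m-j)/r⌉, the one
-- with j = t, from q to q+1, which multiplies the product by φ_r({q+1}).

module Submission where

open import Defs
open import Level using (Level)
open import Algebra.Bundles using (CommutativeRing)
open import Data.Nat using (ℕ; zero; suc; _≟_; _≤_; _<_; s≤s; z≤n; NonZero)
  renaming (_+_ to _+ℕ_; _*_ to _*ℕ_)
import Data.Nat.Properties as ℕₚ
open import Data.Nat.DivMod using (_%_; _/_; m/n≤m; m%n<n)
open import Data.Nat.ListAction using (sum)
open import Data.List using (List; []; _∷_; _++_; map; filter; concatMap; applyUpTo; upTo)
open import Data.List.Properties using (filter-++; map-++; map-∘; map-upTo; ++-identityʳ; filter-none)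
open import Data.List.Relation.Unary.All using (universal)
open import Data.List.Relation.Unary.All.Properties using (map⁺)
open import Data.Product using (_,_)
open import Function using (_∘′_)
open import Relation.Binary.PropositionalEquality using (_≢_; cong; cong₂; subst)
  renaming (sym to ≡-sym; trans to ≡-trans)

module CeilDiv where

  open import Data.Nat using (_+_; _*_; _∸_; >-nonZero⁻¹)
  open import Data.Nat.Properties
  open import Data.Nat.DivMod
  open import Data.Nat.Divisibility using (divides-refl)
  open import Data.Nat.ListAction.Properties using (sum-++)
  open import Data.List.Properties using (upTo-∷ʳ)
  open import Relation.Binary.PropositionalEquality
  open import Relation.Binary.Definitions using (Tri; tri<; tri≈; tri>)
  open import Relation.Nullary using (contradiction)

  module _ {r : ℕ} .{{_ : NonZero r}} where

    [a+q*r]/r≡q : ∀ {a} q → a < r → (a + q * r) / r ≡ q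
    [a+q*r]/r≡q {a} q a<r = begin
      (a + q * r) / r   ≡⟨ +-distrib-/-∣ʳ a (divides-refl q) ⟩
      a / r + q * r / r ≡⟨ cong₂ _+_ (m<n⇒m/n≡0 a<r) (m*n/n≡m q r) ⟩
      q                 ∎
      where open ≡-Reasoning

    [1+a+q*r]/r≡[a+q*r]/r : ∀ {a} q → suc a < r → (suc a + q * r) / r ≡ (a + q * r) / r
    [1+a+q*r]/r≡[a+q*r]/r q 1+a<r = trans ([a+q*r]/r≡q q 1+a<r) (sym ([a+q*r]/r≡q q (<-trans (n<1+n _) 1+a<r)))

    ceilDiv≡[m+gap]/r : ∀ m {j} → j < r → ceilDiv m j r ≡ (m + (r ∸ suc j)) / r
    ceilDiv≡[m+gap]/r m {j} j<r = /-congˡ (trans (∸-+-assoc (m + r) 1 j) (+-∸-assoc m j<r))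

    ceilDiv-zero : ∀ {j} → j < r → ceilDiv 0 j r ≡ 0
    ceilDiv-zero {j} j<r = trans (ceilDiv≡[m+gap]/r 0 j<r) (m<n⇒m/n≡0 gap<r)
      where
      gap<r : r ∸ suc j < r
      gap<r = ≤-trans (s≤s (m≤n+m (r ∸ suc j) j)) (≤-reflexive (m+[n∸m]≡n j<r))

  -- Write m = t + q r with t = m % r. For j < r put k = r ∸ suc j, so that
  -- ceilDiv m j r = ((t + k) + q r) / r and j + k + 1 = r: passing from m to
  -- m + 1 crosses a multiple of r exactly when t + k + 1 = r, i.e. when j = t.
  module _ (m : ℕ) {r : ℕ} .{{_ : NonZero r}} where
    private
      t = m % r
      q = m / r

      t<r : t < r
      t<r = m%n<n m r

      m+k≡t+k+q*r : ∀ k → m + k ≡ (t + k) + q * r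
      m+k≡t+k+q*r k = begin
        m + k               ≡⟨ cong (_+ k) (m≡m%n+[m/n]*n m r) ⟩
        t + q * r + k       ≡⟨ +-assoc t (q * r) k ⟩
        t + (q * r + k)     ≡⟨ cong (t +_) (+-comm (q * r) k) ⟩
        t + (k + q * r)     ≡⟨ +-assoc t k (q * r) ⟨
        (t + k) + q * r     ∎
        where open ≡-Reasoning

    ceilDiv-rem : ceilDiv m (m % r) r ≡ m / r
    ceilDiv-rem = begin
      ceilDiv m t r             ≡⟨ ceilDiv≡[m+gap]/r m t<r ⟩
      (m + k) / r               ≡⟨ /-congˡ (m+k≡t+k+q*r k) ⟩
      ((t + k) + q * r) / r     ≡⟨ [a+q*r]/r≡q q (≤-reflexive (m+[n∸m]≡n t<r)) ⟩
      q                         ∎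
      where
      open ≡-Reasoning
      k = r ∸ suc t

    ceilDiv-suc-rem : ceilDiv (suc m) (m % r) r ≡ suc (m / r)
    ceilDiv-suc-rem = begin
      ceilDiv (suc m) t r       ≡⟨ ceilDiv≡[m+gap]/r (suc m) t<r ⟩
      (suc m + k) / r           ≡⟨ /-congˡ (cong suc (m+k≡t+k+q*r k)) ⟩
      (suc (t + k) + q * r) / r ≡⟨ /-congˡ (cong (_+ q * r) (m+[n∸m]≡n t<r)) ⟩
      (0 + suc q * r) / r       ≡⟨ [a+q*r]/r≡q (suc q) (>-nonZero⁻¹ r) ⟩
      suc q                     ∎
      where
      open ≡-Reasoning
      k = r ∸ suc t

    ceilDiv-suc-≢rem : ∀ {j} → j < r → j ≢ m % r → ceilDiv (suc m) j r ≡ ceilDiv m j r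
    ceilDiv-suc-≢rem {j} j<r j≢t = begin
      ceilDiv (suc m) j r         ≡⟨ ceilDiv≡[m+gap]/r (suc m) j<r ⟩
      (suc m + k) / r             ≡⟨ /-congˡ (cong suc (m+k≡t+k+q*r k)) ⟩
      (suc (t + k) + q * r) / r   ≡⟨ sameQuotient (<-cmp j t) ⟩
      ((t + k) + q * r) / r       ≡⟨ /-congˡ (m+k≡t+k+q*r k) ⟨
      (m + k) / r                 ≡⟨ ceilDiv≡[m+gap]/r m j<r ⟨
      ceilDiv m j r               ∎
      where
      open ≡-Reasoning
      k = r ∸ suc j
      sameQuotient : Tri (j < t) (j ≡ t) (t < j) → (suc (t + k) + q * r) / r ≡ ((t + k) + q * r) / r
      sameQuotient (tri≈ _ j≡t _) = contradiction j≡t j≢t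
      sameQuotient (tri> _ _ t<j) = [1+a+q*r]/r≡[a+q*r]/r q
        (≤-trans (s≤s (+-monoˡ-< k t<j)) (≤-reflexive (m+[n∸m]≡n j<r)))
      sameQuotient (tri< j<t _ _) = begin
        (suc (t + k) + q * r) / r   ≡⟨ /-congˡ (cong (λ x → suc x + q * r) t+k≡e+r) ⟩
        (suc (e + r) + q * r) / r   ≡⟨ /-congˡ (cong suc (+-assoc e r (q * r))) ⟩
        (suc e + suc q * r) / r     ≡⟨ [1+a+q*r]/r≡[a+q*r]/r (suc q) 1+e<r ⟩
        (e + suc q * r) / r         ≡⟨ /-congˡ (+-assoc e r (q * r)) ⟨
        ((e + r) + q * r) / r       ≡⟨ /-congˡ (cong (_+ q * r) t+k≡e+r) ⟨
        ((t + k) + q * r) / r       ∎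
        where
        e = t ∸ suc j
        t+k≡e+r : t + k ≡ e + r
        t+k≡e+r = trans (sym (+-∸-assoc t j<r)) (+-∸-comm r j<t)
        1+e<r : suc e < r
        1+e<r = ≤-<-trans (≤-trans (s≤s (m≤n+m e j)) (≤-reflexive (m+[n∸m]≡n j<t))) t<r

  h-suc : ∀ r .{{_ : NonZero r}} m → h r (suc m) ≡ h r m + m % r
  h-suc r m = begin
    sum (map (_% r) (upTo (suc m)))               ≡⟨ cong (sum ∘′ map (_% r)) (upTo-∷ʳ m) ⟨
    sum (map (_% r) (upTo m ++ m ∷ []))           ≡⟨ cong sum (map-++ (_% r) (upTo m) (m ∷ [])) ⟩
    sum (map (_% r) (upTo m) ++ m % r ∷ [])       ≡⟨ sum-++ (map (_% r) (upTo m)) (m % r ∷ []) ⟩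
    h r m + (m % r + 0)                           ≡⟨ cong (h r m +_) (+-identityʳ (m % r)) ⟩
    h r m + m % r                                 ∎
    where open ≡-Reasoning

open CeilDiv

module Words where

  open import Data.Nat using (_+_; _*_)
  open import Data.Nat.Properties
  open import Data.Nat.DivMod
  open import Data.List using (replicate)
  open import Data.List.Properties
  open import Data.Product using (proj₁; proj₂)
  open import Function using (_∘_)
  open import Relation.Binary.PropositionalEquality
  open import Relation.Nullary using (yes; no)
  open import Relation.Unary using (Pred; Decidable; _≐_)

  module _ {a b p q} {A : Set a} {B : Set b} {P : Pred A p} {Q : Pred B q}
           (P? : Decidable P) (Q? : Decidable Q) {f : A → B} where

    filter-map : P ≐ (Q ∘ f) → filter Q? ∘ map f ≗ map f ∘ filter P?
    filter-map P≐Qf [] = refl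
    filter-map P≐Qf (x ∷ xs) with P? x
    ... | yes Px = trans (filter-accept Q? (proj₁ P≐Qf Px)) (cong (f x ∷_) (filter-map P≐Qf xs))
    ... | no ¬Px = trans (filter-reject Q? (¬Px ∘ proj₂ P≐Qf)) (filter-map P≐Qf xs)

  wordsUpTo : List ℕ → ℕ → List (List ℕ)
  wordsUpTo A N = concatMap (wordsOfLength A) (upTo N)

  wordsOfLength-map : ∀ (f : ℕ → ℕ) A l → wordsOfLength (map f A) l ≡ map (map f) (wordsOfLength A l)
  wordsOfLength-map f A zero    = refl
  wordsOfLength-map f A (suc l) = begin
    concatMap (λ a → map (a ∷_) (wordsOfLength (map f A) l)) (map f A)
      ≡⟨ concatMap-map _ f A ⟩
    concatMap (λ a → map (f a ∷_) (wordsOfLength (map f A) l)) A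
      ≡⟨ concatMap-cong (λ a → cong (map (f a ∷_)) (wordsOfLength-map f A l)) A ⟩
    concatMap (λ a → map (f a ∷_) (map (map f) (wordsOfLength A l))) A
      ≡⟨ concatMap-cong (λ a → trans (sym (map-∘ (wordsOfLength A l))) (map-∘ (wordsOfLength A l))) A ⟩
    concatMap (λ a → map (map f) (map (a ∷_) (wordsOfLength A l))) A
      ≡⟨ map-concatMap (map f) _ A ⟨
    map (map f) (wordsOfLength A (suc l))
      ∎
    where open ≡-Reasoning

  wordsUpTo-map : ∀ (f : ℕ → ℕ) A N → wordsUpTo (map f A) N ≡ map (map f) (wordsUpTo A N)
  wordsUpTo-map f A N = trans (concatMap-cong (wordsOfLength-map f A) (upTo N))
                              (sym (map-concatMap (map f) (wordsOfLength A) (upTo N)))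

  wordsUpTo-suc : ∀ A N → wordsUpTo A (suc N) ≡ [] ∷ concatMap (wordsOfLength A ∘′ suc) (upTo N)
  wordsUpTo-suc A N = cong ([] ∷_) (trans (cong (concatMap (wordsOfLength A)) (sym (map-upTo suc N)))
                                          (concatMap-map (wordsOfLength A) suc (upTo N)))

  sum-map-*ˡ : ∀ k ns → sum (map (k *_) ns) ≡ k * sum ns
  sum-map-*ˡ k []       = sym (*-zeroʳ k)
  sum-map-*ˡ k (n ∷ ns) = trans (cong (k * n +_) (sum-map-*ˡ k ns)) (sym (*-distribˡ-+ k n (sum ns)))

  onesThenScaled : ℕ → ℕ → List ℕ → List ℕ
  onesThenScaled t r w = replicate t 1 ++ map (r *_) w

  sum-onesThenScaled : ∀ t r w → sum (onesThenScaled t r w) ≡ t + r * sum w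
  sum-onesThenScaled zero    r w = sum-map-*ˡ r w
  sum-onesThenScaled (suc t) r w = cong suc (sum-onesThenScaled t r w)

  Δ≡map-onesThenScaled : ∀ m r .{{_ : NonZero r}} →
    Δ m r ≡ map (onesThenScaled (m % r) r) (filter (λ w → sum w ≟ m / r) (wordsUpTo (1 ∷ 2 ∷ []) (suc m)))
  Δ≡map-onesThenScaled m r = begin
    filter (λ w → sum w ≟ m) (map (replicate t 1 ++_) (wordsUpTo (r ∷ 2 * r ∷ []) (suc m)))
      ≡⟨ cong (λ A → filter (λ w → sum w ≟ m) (map (replicate t 1 ++_) (wordsUpTo A (suc m)))) tiles ⟩
    filter (λ w → sum w ≟ m) (map (replicate t 1 ++_) (wordsUpTo (map (r *_) (1 ∷ 2 ∷ [])) (suc m)))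
      ≡⟨ cong (filter (λ w → sum w ≟ m) ∘′ map (replicate t 1 ++_)) (wordsUpTo-map (r *_) _ (suc m)) ⟩
    filter (λ w → sum w ≟ m) (map (replicate t 1 ++_) (map (map (r *_)) Z))
      ≡⟨ cong (filter (λ w → sum w ≟ m)) (map-∘ {g = replicate t 1 ++_} {f = map (r *_)} Z) ⟨
    filter (λ w → sum w ≟ m) (map (onesThenScaled t r) Z)
      ≡⟨ filter-map (λ w → sum w ≟ m / r) (λ w → sum w ≟ m) (tiles-q , tiles-m) Z ⟩
    map (onesThenScaled t r) (filter (λ w → sum w ≟ m / r) Z)
      ∎
    where
    open ≡-Reasoning
    t = m % r
    Z = wordsUpTo (1 ∷ 2 ∷ []) (suc m)

    tiles : r ∷ 2 * r ∷ [] ≡ map (r *_) (1 ∷ 2 ∷ [])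
    tiles = cong₂ _∷_ (sym (*-identityʳ r)) (cong (_∷ []) (*-comm 2 r))

    m≡t+r*q : m ≡ t + r * (m / r)
    m≡t+r*q = trans (m≡m%n+[m/n]*n m r) (cong (t +_) (*-comm (m / r) r))

    tiles-q : ∀ {w} → sum w ≡ m / r → sum (onesThenScaled t r w) ≡ m
    tiles-q {w} eq = trans (sum-onesThenScaled t r w) (trans (cong (λ n → t + r * n) eq) (sym m≡t+r*q))

    tiles-m : ∀ {w} → sum (onesThenScaled t r w) ≡ m → sum w ≡ m / r
    tiles-m {w} eq = *-cancelˡ-≡ (sum w) (m / r) r
      (+-cancelˡ-≡ t _ _ (trans (sym (sum-onesThenScaled t r w)) (trans eq m≡t+r*q)))

open Words

module _ {c ℓ : Level} (R : CommutativeRing c ℓ) (s : ℕ → CommutativeRing.Carrier R) where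
  open CommutativeRing R
  open Poly R s
  open import Relation.Binary.Reasoning.Setoid setoid
  open import Algebra.Properties.CommutativeSemigroup +-commutativeSemigroup
    using () renaming (interchange to +-interchange)
  open import Algebra.Properties.CommutativeSemigroup *-commutativeSemigroup
    using (x∙yz≈y∙xz) renaming (interchange to *-interchange)

  sumR-++ : ∀ xs ys → sumR (xs ++ ys) ≈ sumR xs + sumR ys
  sumR-++ []       ys = sym (+-identityˡ _)
  sumR-++ (x ∷ xs) ys = trans (+-congˡ (sumR-++ xs ys)) (sym (+-assoc _ _ _))

  sumR-map-cong : ∀ {A : Set} {f g : A → Carrier} → (∀ x → f x ≈ g x) →
                  ∀ xs → sumR (map f xs) ≈ sumR (map g xs)
  sumR-map-cong f≈g []       = refl
  sumR-map-cong f≈g (x ∷ xs) = +-cong (f≈g x) (sumR-map-cong f≈g xs)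

  sumR-map-*ˡ : ∀ {A : Set} (f : A → Carrier) a xs → sumR (map (λ x → a * f x) xs) ≈ a * sumR (map f xs)
  sumR-map-*ˡ f a []       = sym (zeroʳ a)
  sumR-map-*ˡ f a (x ∷ xs) = trans (+-congˡ (sumR-map-*ˡ f a xs)) (sym (distribˡ a _ _))

  pow-+ : ∀ x m n → pow x (m +ℕ n) ≈ pow x m * pow x n
  pow-+ x zero    n = sym (*-identityˡ _)
  pow-+ x (suc m) n = trans (*-congˡ (pow-+ x m n)) (sym (*-assoc _ _ _))

  prod-applyUpTo-cong : ∀ n {f g : ℕ → Carrier} → (∀ {j} → j < n → f j ≈ g j) →
                        prod (applyUpTo f n) ≈ prod (applyUpTo g n)
  prod-applyUpTo-cong zero    f≈g = refl
  prod-applyUpTo-cong (suc n) f≈g = *-cong (f≈g (s≤s z≤n)) (prod-applyUpTo-cong n (f≈g ∘′ s≤s))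

  prod-applyUpTo-scaleAt : ∀ n {f g : ℕ → Carrier} {t a} → t < n →
                           (∀ {j} → j < n → j ≢ t → f j ≈ g j) → f t ≈ a * g t →
                           prod (applyUpTo f n) ≈ a * prod (applyUpTo g n)
  prod-applyUpTo-scaleAt (suc n) {t = zero} _ f≈g ft≈agt =
    trans (*-cong ft≈agt (prod-applyUpTo-cong n (λ j<n → f≈g (s≤s j<n) λ ()))) (*-assoc _ _ _)
  prod-applyUpTo-scaleAt (suc n) {t = suc t} (s≤s t<n) f≈g ft≈agt =
    trans (*-cong (f≈g (s≤s z≤n) λ ()) (prod-applyUpTo-scaleAt n t<n
                    (λ j<n j≢t → f≈g (s≤s j<n) (j≢t ∘′ ℕₚ.suc-injective)) ft≈agt))
          (x∙yz≈y∙xz _ _ _)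

  prod-applyUpTo-1# : ∀ n {f : ℕ → Carrier} → (∀ {j} → j < n → f j ≈ 1#) →
                      prod (applyUpTo f n) ≈ 1#
  prod-applyUpTo-1# zero    f≈1 = refl
  prod-applyUpTo-1# (suc n) f≈1 =
    trans (*-cong (f≈1 (s≤s z≤n)) (prod-applyUpTo-1# n (f≈1 ∘′ s≤s))) (*-identityˡ 1#)

  module _ (σ : ℕ → Carrier) where

    weight : List ℕ → Carrier
    weight w = prod (map σ w)

    tilingWeight : ℕ → List (List ℕ) → Carrier
    tilingWeight n ws = sumR (map weight (filter (λ w → sum w ≟ n) ws))

    tilingWeight-++ : ∀ n xs ys → tilingWeight n (xs ++ ys) ≈ tilingWeight n xs + tilingWeight n ys
    tilingWeight-++ n xs ys = begin
      sumR (map weight (filter P? (xs ++ ys)))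
        ≡⟨ cong (sumR ∘′ map weight) (filter-++ P? xs ys) ⟩
      sumR (map weight (filter P? xs ++ filter P? ys))
        ≡⟨ cong sumR (map-++ weight (filter P? xs) (filter P? ys)) ⟩
      sumR (map weight (filter P? xs) ++ map weight (filter P? ys))
        ≈⟨ sumR-++ (map weight (filter P? xs)) _ ⟩
      tilingWeight n xs + tilingWeight n ys
        ∎
      where P? = λ w → sum w ≟ n

    tilingWeight-∷ : ∀ a n ws → tilingWeight (a +ℕ n) (map (a ∷_) ws) ≈ σ a * tilingWeight n ws
    tilingWeight-∷ a n ws = begin
      sumR (map weight (filter (λ w → sum w ≟ a +ℕ n) (map (a ∷_) ws)))
        ≡⟨ cong (sumR ∘′ map weight) (filter-map (λ w → sum w ≟ n) (λ w → sum w ≟ a +ℕ n)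
                                                 (cong (a +ℕ_) , ℕₚ.+-cancelˡ-≡ a _ _) ws) ⟩
      sumR (map weight (map (a ∷_) V))             ≡⟨ cong sumR (map-∘ V) ⟨
      sumR (map (λ w → σ a * weight w) V)          ≈⟨ sumR-map-*ˡ weight (σ a) V ⟩
      σ a * tilingWeight n ws                      ∎
      where V = filter (λ w → sum w ≟ n) ws

    tilingWeight-∷-< : ∀ {a n} ws → n < a → tilingWeight n (map (a ∷_) ws) ≈ 0#
    tilingWeight-∷-< {a} {n} ws n<a =
      reflexive (cong (sumR ∘′ map weight) (filter-none (λ w → sum w ≟ n) (map⁺ (universal too-long ws))))
      where
      too-long : ∀ w → sum (a ∷ w) ≢ n
      too-long w a+w≡n = ℕₚ.<⇒≱ n<a (subst (a ≤_) a+w≡n (ℕₚ.m≤m+n a (sum w)))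

    tilingWeight-concatMap-suc : ∀ n xs →
      tilingWeight n (concatMap (wordsOfLength (1 ∷ 2 ∷ []) ∘′ suc) xs)
        ≈ tilingWeight n (map (1 ∷_) (concatMap (wordsOfLength (1 ∷ 2 ∷ [])) xs))
          + tilingWeight n (map (2 ∷_) (concatMap (wordsOfLength (1 ∷ 2 ∷ [])) xs))
    tilingWeight-concatMap-suc n []       = sym (+-identityʳ 0#)
    tilingWeight-concatMap-suc n (x ∷ xs) = begin
      tW (W (suc x) ++ concatMap (W ∘′ suc) xs)
        ≈⟨ tilingWeight-++ n (W (suc x)) _ ⟩
      tW (W (suc x)) + tW (concatMap (W ∘′ suc) xs)
        ≈⟨ +-cong W-suc (tilingWeight-concatMap-suc n xs) ⟩
      (tW (map (1 ∷_) (W x)) + tW (map (2 ∷_) (W x))) + (tW (map (1 ∷_) Y) + tW (map (2 ∷_) Y))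
        ≈⟨ +-interchange _ _ _ _ ⟩
      (tW (map (1 ∷_) (W x)) + tW (map (1 ∷_) Y)) + (tW (map (2 ∷_) (W x)) + tW (map (2 ∷_) Y))
        ≈⟨ +-cong (tilingWeight-map-++ 1) (tilingWeight-map-++ 2) ⟨
      tW (map (1 ∷_) (W x ++ Y)) + tW (map (2 ∷_) (W x ++ Y))
        ∎
      where
      W = wordsOfLength (1 ∷ 2 ∷ [])
      tW = tilingWeight n
      Y = concatMap W xs
      W-suc : tW (W (suc x)) ≈ tW (map (1 ∷_) (W x)) + tW (map (2 ∷_) (W x))
      W-suc = trans (tilingWeight-++ n (map (1 ∷_) (W x)) (map (2 ∷_) (W x) ++ []))
                    (+-congˡ (reflexive (cong tW (++-identityʳ (map (2 ∷_) (W x))))))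
      tilingWeight-map-++ : ∀ a → tW (map (a ∷_) (W x ++ Y)) ≈ tW (map (a ∷_) (W x)) + tW (map (a ∷_) Y)
      tilingWeight-map-++ a = trans (reflexive (cong tW (map-++ (a ∷_) (W x) Y)))
                                    (tilingWeight-++ n (map (a ∷_) (W x)) (map (a ∷_) Y))

    tilingWeight-wordsUpTo-suc : ∀ n N →
      tilingWeight n (wordsUpTo (1 ∷ 2 ∷ []) (suc N))
        ≈ tilingWeight n ([] ∷ []) + (tilingWeight n (map (1 ∷_) (wordsUpTo (1 ∷ 2 ∷ []) N))
                                      + tilingWeight n (map (2 ∷_) (wordsUpTo (1 ∷ 2 ∷ []) N)))
    tilingWeight-wordsUpTo-suc n N = begin
      tilingWeight n (wordsUpTo (1 ∷ 2 ∷ []) (suc N))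
        ≡⟨ cong (tilingWeight n) (wordsUpTo-suc (1 ∷ 2 ∷ []) N) ⟩
      tilingWeight n (([] ∷ []) ++ concatMap (wordsOfLength (1 ∷ 2 ∷ []) ∘′ suc) (upTo N))
        ≈⟨ tilingWeight-++ n ([] ∷ []) _ ⟩
      tilingWeight n ([] ∷ []) + tilingWeight n (concatMap (wordsOfLength (1 ∷ 2 ∷ []) ∘′ suc) (upTo N))
        ≈⟨ +-congˡ (tilingWeight-concatMap-suc n (upTo N)) ⟩
      tilingWeight n ([] ∷ []) + (tilingWeight n (map (1 ∷_) (wordsUpTo (1 ∷ 2 ∷ []) N))
                                  + tilingWeight n (map (2 ∷_) (wordsUpTo (1 ∷ 2 ∷ []) N)))
        ∎

    tilingWeight≈lucas : ∀ N n → n < N →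
                         tilingWeight n (wordsUpTo (1 ∷ 2 ∷ []) N) ≈ lucas (σ 1) (σ 2) (suc n)
    tilingWeight≈lucas (suc N) zero _ = begin
      tilingWeight 0 (wordsUpTo (1 ∷ 2 ∷ []) (suc N))
        ≈⟨ tilingWeight-wordsUpTo-suc 0 N ⟩
      (1# + 0#) + (tilingWeight 0 (map (1 ∷_) Y) + tilingWeight 0 (map (2 ∷_) Y))
        ≈⟨ +-cong (+-identityʳ 1#) (+-cong (tilingWeight-∷-< Y (s≤s z≤n))
                                           (tilingWeight-∷-< Y (s≤s z≤n))) ⟩
      1# + (0# + 0#)
        ≈⟨ trans (+-congˡ (+-identityʳ 0#)) (+-identityʳ 1#) ⟩
      1#
        ∎
      where Y = wordsUpTo (1 ∷ 2 ∷ []) N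
    tilingWeight≈lucas (suc N) (suc k) (s≤s k<N) = begin
      tilingWeight (suc k) (wordsUpTo (1 ∷ 2 ∷ []) (suc N))
        ≈⟨ tilingWeight-wordsUpTo-suc (suc k) N ⟩
      0# + (tilingWeight (1 +ℕ k) (map (1 ∷_) Y) + tilingWeight (suc k) (map (2 ∷_) Y))
        ≈⟨ +-identityˡ _ ⟩
      tilingWeight (1 +ℕ k) (map (1 ∷_) Y) + tilingWeight (suc k) (map (2 ∷_) Y)
        ≈⟨ +-cong (trans (tilingWeight-∷ 1 k Y) (*-congˡ (tilingWeight≈lucas N k k<N)))
                  (tilingWeight-2∷ k k<N) ⟩
      σ 1 * lucas (σ 1) (σ 2) (suc k) + σ 2 * lucas (σ 1) (σ 2) k
        ∎
      where
      Y = wordsUpTo (1 ∷ 2 ∷ []) N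
      tilingWeight-2∷ : ∀ i → i < N → tilingWeight (suc i) (map (2 ∷_) Y) ≈ σ 2 * lucas (σ 1) (σ 2) i
      tilingWeight-2∷ zero    _     = trans (tilingWeight-∷-< Y (s≤s (s≤s z≤n))) (sym (zeroʳ (σ 2)))
      tilingWeight-2∷ (suc i) 1+i<N =
        trans (tilingWeight-∷ 2 i Y) (*-congˡ (tilingWeight≈lucas N i (ℕₚ.<-trans (ℕₚ.n<1+n i) 1+i<N)))

  wt-onesThenScaled : ∀ t r w → wt (onesThenScaled t r w) ≈ pow (s 1) t * weight (s ∘′ (r *ℕ_)) w
  wt-onesThenScaled zero    r w = trans (reflexive (cong prod (≡-sym (map-∘ w)))) (sym (*-identityˡ _))
  wt-onesThenScaled (suc t) r w = trans (*-congˡ (wt-onesThenScaled t r w)) (sym (*-assoc _ _ _))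

  rLucas-suc : ∀ r .{{_ : NonZero r}} m →
               rLucas r (suc m) ≈ pow (s 1) (m % r) * lucas (s r) (s (2 *ℕ r)) (suc (m / r))
  rLucas-suc r m = begin
    sumR (map wt (Δ m r))
      ≡⟨ cong (sumR ∘′ map wt) (Δ≡map-onesThenScaled m r) ⟩
    sumR (map wt (map (onesThenScaled t r) V))
      ≡⟨ cong sumR (map-∘ V) ⟨
    sumR (map (wt ∘′ onesThenScaled t r) V)
      ≈⟨ sumR-map-cong (wt-onesThenScaled t r) V ⟩
    sumR (map (λ w → pow (s 1) t * weight σ w) V)
      ≈⟨ sumR-map-*ˡ (weight σ) (pow (s 1) t) V ⟩
    pow (s 1) t * tilingWeight σ q (wordsUpTo (1 ∷ 2 ∷ []) (suc m))
      ≈⟨ *-congˡ (tilingWeight≈lucas σ (suc m) q (s≤s (m/n≤m m r))) ⟩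
    pow (s 1) t * lucas (s (r *ℕ 1)) (s (r *ℕ 2)) (suc q)
      ≡⟨ cong₂ (λ a b → pow (s 1) t * lucas (s a) (s b) (suc q))
               (ℕₚ.*-identityʳ r) (ℕₚ.*-comm r 2) ⟩
    pow (s 1) t * lucas (s r) (s (2 *ℕ r)) (suc q)
      ∎
    where
    t = m % r
    q = m / r
    σ = s ∘′ (r *ℕ_)
    V = filter (λ w → sum w ≟ q) (wordsUpTo (1 ∷ 2 ∷ []) (suc m))

  rhs-zero : ∀ r .{{_ : NonZero r}} → rhs r 0 ≈ 1#
  rhs-zero r = begin
    1# * prod (map (λ j → φLucasFact r (ceilDiv 0 j r)) (upTo r))
      ≈⟨ *-identityˡ _ ⟩
    prod (map (λ j → φLucasFact r (ceilDiv 0 j r)) (upTo r))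
      ≡⟨ cong prod (map-upTo _ r) ⟩
    prod (applyUpTo (λ j → φLucasFact r (ceilDiv 0 j r)) r)
      ≈⟨ prod-applyUpTo-1# r (λ j<r → reflexive (cong (φLucasFact r) (ceilDiv-zero j<r))) ⟩
    1#
      ∎

  rhs-suc : ∀ r .{{_ : NonZero r}} m →
            rhs r (suc m) ≈ (pow (s 1) (m % r) * lucas (s r) (s (2 *ℕ r)) (suc (m / r))) * rhs r m
  rhs-suc r m = begin
    pow (s 1) (h r (suc m)) * prod (map (φ (suc m)) (upTo r))
      ≡⟨ cong₂ (λ e xs → pow (s 1) e * prod xs)
               (≡-trans (h-suc r m) (ℕₚ.+-comm (h r m) t)) (map-upTo (φ (suc m)) r) ⟩
    pow (s 1) (t +ℕ h r m) * prod (applyUpTo (φ (suc m)) r)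
      ≈⟨ *-cong (pow-+ (s 1) t (h r m)) φ-suc ⟩
    (pow (s 1) t * pow (s 1) (h r m)) * (L * prod (applyUpTo (φ m) r))
      ≈⟨ *-interchange _ _ _ _ ⟩
    (pow (s 1) t * L) * (pow (s 1) (h r m) * prod (applyUpTo (φ m) r))
      ≡⟨ cong (λ xs → (pow (s 1) t * L) * (pow (s 1) (h r m) * prod xs)) (map-upTo (φ m) r) ⟨
    (pow (s 1) t * L) * rhs r m
      ∎
    where
    t = m % r
    L = lucas (s r) (s (2 *ℕ r)) (suc (m / r))
    φ : ℕ → ℕ → Carrier
    φ n j = φLucasFact r (ceilDiv n j r)
    φ-suc : prod (applyUpTo (φ (suc m)) r) ≈ L * prod (applyUpTo (φ m) r)
    φ-suc = prod-applyUpTo-scaleAt r (m%n<n m r)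
      (λ j<r j≢t → reflexive (cong (φLucasFact r) (ceilDiv-suc-≢rem m j<r j≢t)))
      (reflexive (≡-trans (cong (φLucasFact r) (ceilDiv-suc-rem m))
                          (cong (λ k → L * φLucasFact r k) (≡-sym (ceilDiv-rem m)))))

lemma4p3 : ∀ {c ℓ : Level} (R : CommutativeRing c ℓ) (s : ℕ → CommutativeRing.Carrier R)
             (r : ℕ) .{{_ : NonZero r}} (m : ℕ) →
             CommutativeRing._≈_ R (Poly.rLucasFact R s r m) (Poly.rhs R s r m)
lemma4p3 R s r zero    = CommutativeRing.sym R (rhs-zero R s r)
lemma4p3 R s r (suc m) = begin
  rLucas r (suc m) * rLucasFact r m
    ≈⟨ *-cong (rLucas-suc R s r m) (lemma4p3 R s r m) ⟩
  (pow (s 1) (m % r) * lucas (s r) (s (2 *ℕ r)) (suc (m / r))) * rhs r m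
    ≈⟨ rhs-suc R s r m ⟨
  rhs r (suc m)
    ∎
  where
  open CommutativeRing R
  open Poly R s
  open import Relation.Binary.Reasoning.Setoid setoid
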